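{- Let $n_0$ be a positive integer and $\tau,\eta$ constants with $1/n_0\ll\tau\ll\eta<1$. Suppose that $G$ is a digraph on $n\geq n_0$ vertices satisfying, for all $i<n/2$, (i) $d^+_i \geq i+\eta n$ or $d^-_{n-i-\eta n}\geq n-i$, and (ii) $d^-_i \geq i+\eta n$ or $d^+_{n-i-\eta n}\geq n-i$. Then $\delta^0(G)\geq \eta n$ and $G$ is a robust $(\tau^2,\tau)$-outexpander.
   Context: For a digraph $G$ on $n$ vertices, $d^+_1\leq\cdots\leq d^+_n$ is the nondecreasing list of outdegrees and $d^-_1\leq\cdots\leq d^-_n$ the nondecreasing list of indegrees; floors and ceilings of indices are ignored. $\delta^0(G)=\min(\delta^+(G),\delta^-(G))$. For $S\subseteq V(G)$, $RN^+_{\nu,G}(S)$ is the set of vertices having at least $\nu n$ inneighbours in $S$; $G$ is a robust $(\nu,\tau)$-outexpander if $|RN^+_{\nu,G}(S)|\geq|S|+\nu n$ for all $S\subseteq V(G)$ with $\tau n<|S|<(1-\tau)n$. The notation $a\ll b$ means there is an increasing function $f$ such that the statement holds whenever $a\leq f(b)$.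
   Formalization: The constants τ and η in the hierarchy $1/n_0\ll\tau\ll\eta<1$ range over the rationals. -}

module Defs where

open import Data.Bool using (Bool; true; false; T; _∧_)
open import Data.Nat as ℕ using (ℕ; zero; suc)
open import Data.Nat.Properties using (≤-decTotalOrder)
open import Data.Integer as ℤ using (ℤ; +_; -[1+_])
open import Data.Rational as ℚ using (ℚ; _/_; floor)
open import Data.Fin using (Fin)
open import Data.Fin.Subset using (Subset; _∈_; ∣_∣; inside; outside)
open import Data.Vec using (tabulate)
open import Data.List using (List; []; _∷_; map; length; filter)
open import Data.List.Sort ≤-decTotalOrder using (sort)
open import Data.Fin.Base using () renaming (toℕ to finToℕ)
open import Data.List using (allFin)
open import Relation.Nullary using (Dec; yes; no; ¬_)
open import Relation.Nullary.Decidable using (does; T?)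
open import Data.Fin.Subset.Properties using (_∈?_)
open import Relation.Binary.PropositionalEquality using (_≡_)
import Data.Rational.Properties as ℚP
open import Data.Product using (_×_)
open import Data.Sum using (_⊎_)

-- A digraph on vertex set Fin n: loopless, no multiple arcs (arcs in both
-- directions between two vertices are allowed). adj u v = true iff u → v.
record Digraph (n : ℕ) : Set where
  field
    adj      : Fin n → Fin n → Bool
    loopless : ∀ v → adj v v ≡ false
open Digraph public

countV : ∀ {n} → (Fin n → Bool) → ℕ
countV {n} p = length (filter (λ v → T? (p v)) (allFin n))

outdeg : ∀ {n} → Digraph n → Fin n → ℕ
outdeg G u = countV (λ v → adj G u v)

indeg : ∀ {n} → Digraph n → Fin n → ℕ
indeg G v = countV (λ u → adj G u v)

-- 1-indexed lookup in a list; indices ≤ 0 or beyond the length give 0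
nth : List ℕ → ℤ → ℕ
nth [] k = 0
nth (x ∷ xs) (+ 1) = x
nth (x ∷ xs) (+ suc (suc k)) = nth xs (+ suc k)
nth (x ∷ xs) (+ 0) = 0
nth (x ∷ xs) -[1+ k ] = 0

d⁺ : ∀ {n} → Digraph n → ℤ → ℕ
d⁺ {n} G k = nth (sort (map (outdeg G) (allFin n))) k

d⁻ : ∀ {n} → Digraph n → ℤ → ℕ
d⁻ {n} G k = nth (sort (map (indeg G) (allFin n))) k

⟦_⟧ : ℕ → ℚ
⟦ m ⟧ = (+ m) / 1

inNbrsIn : ∀ {n} → Digraph n → Subset n → Fin n → ℕ
inNbrsIn G S v = countV (λ u → does (u ∈? S) ∧ adj G u v)

RN⁺ : ∀ {n} → ℚ → Digraph n → Subset n → Subset n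
RN⁺ {n} ν G S =
  tabulate (λ v → does ((ν ℚ.* ⟦ n ⟧) ℚP.≤? ⟦ inNbrsIn G S v ⟧))

RobustOutexpander : ∀ {n} → Digraph n → ℚ → ℚ → Set
RobustOutexpander {n} G ν τ =
  (S : Subset n) →
  τ ℚ.* ⟦ n ⟧ ℚ.< ⟦ ∣ S ∣ ⟧ →
  ⟦ ∣ S ∣ ⟧ ℚ.< (ℚ.1ℚ ℚ.- τ) ℚ.* ⟦ n ⟧ →
  ⟦ ∣ S ∣ ⟧ ℚ.+ ν ℚ.* ⟦ n ⟧ ℚ.≤ ⟦ ∣ RN⁺ ν G S ∣ ⟧

MinSemidegreeAtLeast : ∀ {n} → Digraph n → ℚ → Set
MinSemidegreeAtLeast G x = ∀ v → x ℚ.≤ ⟦ outdeg G v ⟧ × x ℚ.≤ ⟦ indeg G v ⟧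

shiftIdx : ℕ → ℕ → ℚ → ℤ
shiftIdx n i η = floor (⟦ n ⟧ ℚ.- ⟦ i ⟧ ℚ.- η ℚ.* ⟦ n ⟧)

CondI : ∀ {n} → Digraph n → ℚ → ℕ → Set
CondI {n} G η i =
  ⟦ i ⟧ ℚ.+ η ℚ.* ⟦ n ⟧ ℚ.≤ ⟦ d⁺ G (+ i) ⟧ ⊎ n ℕ.∸ i ℕ.≤ d⁻ G (shiftIdx n i η)

CondII : ∀ {n} → Digraph n → ℚ → ℕ → Set
CondII {n} G η i =
  ⟦ i ⟧ ℚ.+ η ℚ.* ⟦ n ⟧ ℚ.≤ ⟦ d⁻ G (+ i) ⟧ ⊎ n ℕ.∸ i ℕ.≤ d⁺ G (shiftIdx n i η)

module Submission where

-- Let a = ⌊τn⌋, b = ⌊τ(a + 1)⌋ (so τ²n ≤ b + 1) and e = ⌊ηn⌋. For τ ≤ 1/(8Q), where η = P/Q,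
-- and n large, g = e − a − b and h = a − b − 1 are natural numbers with n·b < g·(h + 1).
-- Fix S with τn < |S| < (1 − τ)n and let X = RN⁺(S). Every vertex outside X receives at most
-- b arcs from S, so by double counting at most h vertices of S send g arcs out of X, and fewer
-- than g send h + 1. Suppose |X| ≤ |S| + b and let j = |S| − a, i = n − |S| − a; then 2j < n
-- or 2i < n.
-- If 2j < n, condition (i) fails at j: at least j vertices of S have outdegree < j + e (the others
-- send g arcs out of X), and every vertex of indegree ≥ n − j has at least a > b in-neighbours in
-- S, so lies in X, which is too small to contain the j + e + 1 such vertices that d⁻_k ≥ n − j
-- would provide.
-- If 2i < n, condition (ii) fails at i: the at least i vertices outside X have indegree at most
-- b + a + i < i + e, and d⁺_k ≥ n − i would provide g vertices of S of outdegree ≥ n − i, each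
-- sending h + 1 arcs out of X.
-- The semidegree bound is (i) and (ii) at i = 1: in a loopless digraph a vertex of indegree
-- ≥ n − 1 is an out-neighbour of every other vertex.

open import Defs
open import Data.Nat using (ℕ)
open import Data.Rational as ℚ using (ℚ)
open import Data.Product using (Σ; _×_)

module Counting where

  open import Data.Bool using (Bool; true; false; T; _∧_; not)
  open import Data.Empty using (⊥-elim)
  open import Data.Fin using (Fin; zero; suc; _≟_)
  open import Data.Fin.Subset using (Subset; ∣_∣; inside; outside)
  open import Data.Fin.Subset.Properties using (_∈?_)
  open import Data.List using (length; filterᵇ)
  import Data.List as List
  open import Data.Nat hiding (_≟_)
  open import Data.Nat.Properties hiding (_≟_)
  open import Algebra.Properties.Semiring.Sum +-*-semiring
    using (sum; sum-cong-≗; ∑-distrib-+; ∑-comm; *-distribˡ-sum; *-distribʳ-sum)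
  open import Data.Sum using (_⊎_; inj₁; inj₂)
  open import Data.Unit using (tt)
  open import Data.Vec using ([]; _∷_)
  import Data.Vec as Vec
  open import Function using (_∘_; id)
  open import Relation.Binary.PropositionalEquality
  open import Relation.Nullary using (yes; no; contradiction)
  open import Relation.Nullary.Decidable using (does)

  indicator : Bool → ℕ
  indicator true  = 1
  indicator false = 0

  count : ∀ {n} → (Fin n → Bool) → ℕ
  count p = sum (indicator ∘ p)

  sum-mono-≤ : ∀ {n} {f g : Fin n → ℕ} → (∀ i → f i ≤ g i) → sum f ≤ sum g
  sum-mono-≤ {zero}  f≤g = z≤n
  sum-mono-≤ {suc n} f≤g = +-mono-≤ (f≤g zero) (sum-mono-≤ (f≤g ∘ suc))

  sum-≤-* : ∀ {n} {f : Fin n → ℕ} c → (∀ i → f i ≤ c) → sum f ≤ n * c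
  sum-≤-* {zero}  c f≤c = z≤n
  sum-≤-* {suc n} c f≤c = +-mono-≤ (f≤c zero) (sum-≤-* c (f≤c ∘ suc))

  indicator-mono : ∀ {x y} → (T x → T y) → indicator x ≤ indicator y
  indicator-mono {false}         _   = z≤n
  indicator-mono {true} {true}  _   = ≤-refl
  indicator-mono {true} {false} x⇒y = ⊥-elim (x⇒y tt)

  count-mono : ∀ {n} {p q : Fin n → Bool} → (∀ v → T (p v) → T (q v)) → count p ≤ count q
  count-mono p⇒q = sum-mono-≤ (λ v → indicator-mono (p⇒q v))

  count-≤-+ : ∀ {n} (p q r : Fin n → Bool) → (∀ v → T (p v) → T (q v) ⊎ T (r v)) →
    count p ≤ count q + count r
  count-≤-+ p q r p⇒q∨r = begin
    count p                                        ≤⟨ sum-mono-≤ (λ v → pointwise (p⇒q∨r v)) ⟩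
    sum (λ v → indicator (q v) + indicator (r v))  ≡⟨ ∑-distrib-+ (indicator ∘ q) (indicator ∘ r) ⟩
    count q + count r                              ∎
    where
    open ≤-Reasoning
    pointwise : ∀ {x y z} → (T x → T y ⊎ T z) → indicator x ≤ indicator y + indicator z
    pointwise {false}                 _ = z≤n
    pointwise {true} {true}           _ = s≤s z≤n
    pointwise {true} {false} {true}   _ = s≤s z≤n
    pointwise {true} {false} {false} h with h tt
    ... | inj₁ ()
    ... | inj₂ ()

  count+count-not : ∀ {n} (p : Fin n → Bool) → count p + count (not ∘ p) ≡ n
  count+count-not {n} p = begin
    count p + count (not ∘ p)                            ≡⟨ ∑-distrib-+ (indicator ∘ p) (indicator ∘ not ∘ p) ⟨
    sum (λ v → indicator (p v) + indicator (not (p v))) ≡⟨ sum-cong-≗ (λ v → excluded-middle (p v)) ⟩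
    sum {n} (λ _ → 1)                                    ≡⟨ sum-ones n ⟩
    n                                                    ∎
    where
    open ≡-Reasoning
    excluded-middle : ∀ x → indicator x + indicator (not x) ≡ 1
    excluded-middle true  = refl
    excluded-middle false = refl
    sum-ones : ∀ n → sum {n} (λ _ → 1) ≡ n
    sum-ones zero    = refl
    sum-ones (suc n) = cong suc (sum-ones n)

  count-not-≤ : ∀ {n} (p : Fin n → Bool) {i} → n ∸ i ≤ count p → count (not ∘ p) ≤ i
  count-not-≤ {n} p {i} n∸i≤p = +-cancelʳ-≤ (count p) (count (not ∘ p)) i (begin
    count (not ∘ p) + count p  ≡⟨ +-comm (count (not ∘ p)) (count p) ⟩
    count p + count (not ∘ p)  ≡⟨ count+count-not p ⟩
    n                          ≤⟨ m≤n+m∸n n i ⟩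
    i + (n ∸ i)                ≤⟨ +-monoʳ-≤ i n∸i≤p ⟩
    i + count p                ∎)
    where open ≤-Reasoning

  count-≟ : ∀ {n} (v : Fin n) → count (λ u → does (u ≟ v)) ≡ 1
  count-≟ {suc n} zero    = cong suc (count-false n)
    where
    count-false : ∀ n → count {n} (λ u → does (suc u ≟ zero)) ≡ 0
    count-false zero    = refl
    count-false (suc n) = count-false n
  count-≟ {suc n} (suc v) = count-≟ v

  double-count : ∀ {m n} (A : Fin m → Fin n → Bool) (R : Fin m → Bool) (C : Fin n → Bool)
    {b c : ℕ} →
    (∀ w → T (C w) → count (λ u → R u ∧ A u w) ≤ b) →
    (∀ u → T (R u) → c ≤ count (λ w → C w ∧ A u w)) →
    count R * c ≤ n * b
  double-count {m} {n} A R C {b} {c} column≤b c≤row = begin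
    count R * c
      ≡⟨ *-distribʳ-sum c (indicator ∘ R) ⟩
    sum (λ u → indicator (R u) * c)
      ≤⟨ sum-mono-≤ (λ u → guarded (R u) (c≤row u)) ⟩
    sum (λ u → indicator (R u) * count (λ w → C w ∧ A u w))
      ≡⟨ sum-cong-≗ (λ u → *-distribˡ-sum (indicator (R u)) (λ w → indicator (C w ∧ A u w))) ⟩
    sum (λ u → sum (λ w → indicator (R u) * indicator (C w ∧ A u w)))
      ≡⟨ sum-cong-≗ (λ u → sum-cong-≗ (λ w → exchange (R u) (C w) (A u w))) ⟩
    sum (λ u → sum (λ w → indicator (C w) * indicator (R u ∧ A u w)))
      ≡⟨ ∑-comm (λ u w → indicator (C w) * indicator (R u ∧ A u w)) ⟩
    sum (λ w → sum (λ u → indicator (C w) * indicator (R u ∧ A u w)))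
      ≡⟨ sum-cong-≗ (λ w → *-distribˡ-sum (indicator (C w)) (λ u → indicator (R u ∧ A u w))) ⟨
    sum (λ w → indicator (C w) * count (λ u → R u ∧ A u w))
      ≤⟨ sum-≤-* b (λ w → guarded′ (C w) (column≤b w)) ⟩
    n * b ∎
    where
    open ≤-Reasoning
    guarded : ∀ x {k} → (T x → c ≤ k) → indicator x * c ≤ indicator x * k
    guarded false h = z≤n
    guarded true  h = +-monoˡ-≤ 0 (h tt)
    guarded′ : ∀ x {k} → (T x → k ≤ b) → indicator x * k ≤ b
    guarded′ false h = z≤n
    guarded′ true  h = ≤-trans (≤-reflexive (+-identityʳ _)) (h tt)
    exchange : ∀ x y z → indicator x * indicator (y ∧ z) ≡ indicator y * indicator (x ∧ z)
    exchange false false z     = refl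
    exchange false true  false = refl
    exchange false true  true  = refl
    exchange true  false z     = refl
    exchange true  true  z     = refl

  length-filterᵇ-tabulate : ∀ {A : Set} {n} (p : A → Bool) (h : Fin n → A) →
    length (filterᵇ p (List.tabulate h)) ≡ count (p ∘ h)
  length-filterᵇ-tabulate {n = zero}  p h = refl
  length-filterᵇ-tabulate {n = suc n} p h with p (h zero)
  ... | true  = cong suc (length-filterᵇ-tabulate p (h ∘ suc))
  ... | false = length-filterᵇ-tabulate p (h ∘ suc)

  countV≡count : ∀ {n} (p : Fin n → Bool) → countV p ≡ count p
  countV≡count p = length-filterᵇ-tabulate p id

  ∣∣≡count : ∀ {n} (S : Subset n) → ∣ S ∣ ≡ count (λ v → does (v ∈? S))
  ∣∣≡count []            = refl
  ∣∣≡count (inside  ∷ S) = cong suc (∣∣≡count S)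
  ∣∣≡count (outside ∷ S) = ∣∣≡count S

  ∣tabulate∣≡count : ∀ {n} (p : Fin n → Bool) → ∣ Vec.tabulate p ∣ ≡ count p
  ∣tabulate∣≡count {zero}  p = refl
  ∣tabulate∣≡count {suc n} p with p zero
  ... | true  = cong suc (∣tabulate∣≡count (p ∘ suc))
  ... | false = ∣tabulate∣≡count (p ∘ suc)

  1≤count : ∀ {n} (p : Fin n → Bool) {v} → T (p v) → 1 ≤ count p
  1≤count p {v} pv = ≤-trans (≤-reflexive (sym (count-≟ v))) (count-mono pointwise)
    where
    pointwise : ∀ u → T (does (u ≟ v)) → T (p u)
    pointwise u with u ≟ v
    ... | yes refl = λ _ → pv

  2≤count : ∀ {n} (p : Fin n → Bool) {u w} → u ≢ w → T (p u) → T (p w) → 2 ≤ count p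
  2≤count {n} p {u} {w} u≢w pu pw = begin
    2                                                       ≡⟨ cong₂ _+_ (count-≟ u) (count-≟ w) ⟨
    count (is u) + count (is w)                             ≡⟨ ∑-distrib-+ (indicator ∘ is u) (indicator ∘ is w) ⟨
    sum (λ x → indicator (is u x) + indicator (is w x))     ≤⟨ sum-mono-≤ pointwise ⟩
    count p                                                 ∎
    where
    open ≤-Reasoning
    is : Fin n → Fin n → Bool
    is v x = does (x ≟ v)
    1≤indicator : ∀ {x} → T x → 1 ≤ indicator x
    1≤indicator {true} _ = ≤-refl
    pointwise : ∀ x → indicator (is u x) + indicator (is w x) ≤ indicator (p x)
    pointwise x with x ≟ u | x ≟ w
    ... | yes refl | yes refl = contradiction refl u≢w
    ... | yes refl | no _     = 1≤indicator pu
    ... | no _     | yes refl = 1≤indicator pw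
    ... | no _     | no _     = z≤n

module OrderStatistics where

  open Counting
  open import Data.Bool using (Bool; not)
  open import Data.Fin using (Fin)
  open import Data.Integer using (+_)
  open import Data.List using (List; []; _∷_; length; map; allFin; filterᵇ)
  open import Data.List.Properties using (map-tabulate; filter-none; filter-accept)
  open import Data.List.Relation.Binary.Permutation.Propositional.Properties using (↭-length; filter-↭)
  import Data.List.Relation.Unary.All as All
  open import Data.List.Relation.Unary.Linked using (Linked) renaming (tail to Linked-tail)
  open import Data.List.Relation.Unary.Linked.Properties using (Linked⇒All)
  open import Data.Nat
  open import Data.Nat.Properties
  open import Data.List.Sort ≤-decTotalOrder using (sort; sort-↭; sort-↗)
  open import Data.Product using (Σ; _,_)
  open import Function using (_∘_; id)
  open import Relation.Binary.PropositionalEquality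
  open import Relation.Nullary using (yes; no; contradiction)
  open import Relation.Nullary.Decidable using (T?)
  import Data.List as List

  nth-zero : ∀ xs → nth xs (+ 0) ≡ 0
  nth-zero []      = refl
  nth-zero (_ ∷ _) = refl

  nth-pos : ∀ xs z → 1 ≤ nth xs z → Σ ℕ λ k → z ≡ + k
  nth-pos (_ ∷ _) (+ k) _ = k , refl

  filter-<ᵇ-sorted : ∀ {c x} xs → Linked _≤_ (x ∷ xs) → c ≤ x → filterᵇ (_<ᵇ c) (x ∷ xs) ≡ []
  filter-<ᵇ-sorted {c} xs sorted c≤x =
    filter-none (T? ∘ (_<ᵇ c)) (All.map (λ {y} c≤y y<c → <⇒≱ (<ᵇ⇒< y c y<c) c≤y) (Linked⇒All ≤-trans c≤x sorted))

  nth-sorted-< : ∀ {c} xs → Linked _≤_ xs → ∀ {k} → 1 ≤ k →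
    k ≤ length (filterᵇ (_<ᵇ c) xs) → nth xs (+ k) < c
  nth-sorted-< []       _      1≤k k≤0 = contradiction (≤-trans 1≤k k≤0) λ ()
  nth-sorted-< {c} (x ∷ xs) sorted {k} 1≤k k≤count with x <? c
  ... | no x≮c = contradiction (≤-trans 1≤k (≤-trans k≤count (≤-reflexive none-below))) λ ()
    where
    none-below : length (filterᵇ (_<ᵇ c) (x ∷ xs)) ≡ 0
    none-below = cong length (filter-<ᵇ-sorted xs sorted (≮⇒≥ x≮c))
  ... | yes x<c with k
  ...   | suc zero    = x<c
  ...   | suc (suc k) = nth-sorted-< xs (Linked-tail sorted) (s≤s z≤n)
            (s≤s⁻¹ (subst (suc (suc k) ≤_) (cong length (filter-accept (T? ∘ (_<ᵇ c)) (<⇒<ᵇ x<c))) k≤count))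

  sortedValues : ∀ {n} → (Fin n → ℕ) → List ℕ
  sortedValues {n} f = sort (map f (allFin n))

  length-filterᵇ-sortedValues : ∀ {n} (p : ℕ → Bool) (f : Fin n → ℕ) →
    length (filterᵇ p (sortedValues f)) ≡ count (p ∘ f)
  length-filterᵇ-sortedValues {n} p f = begin
    length (filterᵇ p (sortedValues f))      ≡⟨ ↭-length (filter-↭ (T? ∘ p) (sort-↭ _)) ⟩
    length (filterᵇ p (map f (allFin n)))     ≡⟨ cong (length ∘ filterᵇ p) (map-tabulate id f) ⟩
    length (filterᵇ p (List.tabulate f))      ≡⟨ length-filterᵇ-tabulate p f ⟩
    count (p ∘ f)                             ∎
    where open ≡-Reasoning

  nth-sortedValues-< : ∀ {n} (f : Fin n → ℕ) {c k} → 1 ≤ k → k ≤ count (λ v → f v <ᵇ c) →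
    nth (sortedValues f) (+ k) < c
  nth-sortedValues-< f {c} 1≤k k≤count = nth-sorted-< (sortedValues f) (sort-↗ _) 1≤k
    (subst (_ ≤_) (sym (length-filterᵇ-sortedValues (_<ᵇ c) f)) k≤count)

  nth-sortedValues-≥ : ∀ {n} (f : Fin n → ℕ) {c} k → 1 ≤ c → c ≤ nth (sortedValues f) (+ k) →
    n < k + count (λ v → not (f v <ᵇ c))
  nth-sortedValues-≥ f zero 1≤c c≤0 =
    contradiction (≤-trans 1≤c (≤-trans c≤0 (≤-reflexive (nth-zero (sortedValues f))))) λ ()
  nth-sortedValues-≥ {n} f {c} (suc k) 1≤c c≤nth = begin-strict
    n                      ≡⟨ count+count-not low ⟨
    count low + count high <⟨ +-monoˡ-< (count high) low<1+k ⟩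
    suc k + count high     ∎
    where
    open ≤-Reasoning
    low high : Fin n → Bool
    low v = f v <ᵇ c
    high = not ∘ low
    low<1+k : count low < suc k
    low<1+k = ≰⇒> λ 1+k≤low → <⇒≱ (nth-sortedValues-< f (s≤s z≤n) 1+k≤low) c≤nth

module Expansion where

  open Counting
  open OrderStatistics
  open import Data.Bool using (Bool; true; false; T; _∧_; not)
  open import Data.Bool.Properties using (T-∧)
  open import Data.Empty using (⊥)
  open import Data.Fin using (Fin; _≟_)
  import Data.Integer as ℤ
  open import Data.Nat hiding (_≟_)
  open import Data.Nat.Properties hiding (_≟_)
  open import Data.Nat.Tactic.RingSolver using (solve-∀)
  open import Data.Product using (Σ; _×_; _,_; proj₁; proj₂)
  open import Data.Sum using (_⊎_; inj₁; inj₂)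
  open import Data.Unit using (tt)
  open import Function using (_∘_; Equivalence)
  open import Relation.Binary.PropositionalEquality
  open import Relation.Nullary using (¬_; yes; no; contradiction)
  open import Relation.Nullary.Decidable using (does)

  -- CondII G η is definitionally CondI (transpose G) η.
  transpose : ∀ {n} → Digraph n → Digraph n
  transpose G = record { adj = λ u v → adj G v u ; loopless = loopless G }

  -- Conditions (i)/(ii) with η n replaced by an integer e and the shifted index written as k.
  DegreeCondition : ∀ {n} → Digraph n → ℕ → ℕ → Set
  DegreeCondition {n} G e i =
    i + e ≤ d⁺ G (ℤ.+ i) ⊎ Σ ℕ λ k → k + i + e ≤ n × n ∸ i ≤ d⁻ G (ℤ.+ k)

  T-∧-or-not : ∀ x y → T x → T (x ∧ y) ⊎ T (not y)
  T-∧-or-not true true  _ = inj₁ tt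
  T-∧-or-not x    false _ = inj₂ tt

  T-∧-or-notˡ : ∀ x y → T y → T (x ∧ y) ⊎ T (not x)
  T-∧-or-notˡ true  y t = inj₁ t
  T-∧-or-notˡ false y _ = inj₂ tt

  T-or-not-∧ : ∀ x y → T y → T x ⊎ T (not x ∧ y)
  T-or-not-∧ true  y _ = inj₁ tt
  T-or-not-∧ false y t = inj₂ t

  T-∧-monoˡ : ∀ {x y z} → (T x → T y) → T (x ∧ z) → T (y ∧ z)
  T-∧-monoˡ {true} {true} x⇒y t = t
  T-∧-monoˡ {true} {false} x⇒y t = x⇒y tt

  ¬<ᵇ⇒≥ : ∀ {m n} → T (not (m <ᵇ n)) → n ≤ m
  ¬<ᵇ⇒≥ {m} {n} m≮n with m <ᵇ n in m<ᵇn
  ... | false = ≮⇒≥ λ m<n → subst T m<ᵇn (<⇒<ᵇ m<n)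

  2*m<n⇒m<n : ∀ {m n} → 2 * m < n → m < n
  2*m<n⇒m<n {m} 2m<n = ≤-<-trans (m≤m+n m (m + 0)) 2m<n

  2*i<j+a+a+i : ∀ {i j a} → 1 ≤ a → j + a + a + i ≤ 2 * j → 2 * i < j + a + a + i
  2*i<j+a+a+i {i} {j} {a} 1≤a n≤2j = begin-strict
    2 * i            ≡⟨ cong (i +_) (+-identityʳ i) ⟩
    i + i            <⟨ +-monoˡ-< i i<j ⟩
    j + i            ≤⟨ +-monoˡ-≤ i (m≤m+n j (a + a)) ⟩
    j + (a + a) + i  ≡⟨ cong (_+ i) (+-assoc j a a) ⟨
    j + a + a + i    ∎
    where
    open ≤-Reasoning
    i<j : i < j
    i<j = begin-strict
      i              <⟨ m<n+m i (≤-trans 1≤a (m≤m+n a a)) ⟩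
      a + a + i      ≤⟨ +-cancelˡ-≤ j _ _ (subst₂ _≤_ (regroup j a i) (cong (j +_) (+-identityʳ j)) n≤2j) ⟩
      j              ∎
      where
      regroup : ∀ j a i → j + a + a + i ≡ j + (a + a + i)
      regroup = solve-∀

  module Sparse {n} (G : Digraph n) (S X : Fin n → Bool) (b : ℕ)
    (sparse : ∀ w → T (not (X w)) → count (λ u → S u ∧ adj G u w) ≤ b) where

    private
      A : Fin n → Fin n → Bool
      A = adj G

    indeg-≥⇒∈X : ∀ {j} w → j + suc b ≤ count S → n ∸ j ≤ indeg G w → T (X w)
    indeg-≥⇒∈X {j} w j+b<S n∸j≤indeg with X w in Xw
    ... | true  = tt
    ... | false = contradiction (sparse w (subst (T ∘ not) (sym Xw) tt)) (<⇒≱ (+-cancelˡ-≤ j _ _ (begin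
      j + suc b                                           ≤⟨ j+b<S ⟩
      count S                                             ≤⟨ count-≤-+ S _ _ (λ u → T-∧-or-not (S u) (A u w)) ⟩
      count (λ u → S u ∧ A u w) + count (λ u → not (A u w)) ≤⟨ +-monoʳ-≤ _ non-in≤j ⟩
      count (λ u → S u ∧ A u w) + j                       ≡⟨ +-comm _ j ⟩
      j + count (λ u → S u ∧ A u w)                       ∎)))
      where
      open ≤-Reasoning
      non-in≤j : count (λ u → not (A u w)) ≤ j
      non-in≤j = count-not-≤ (λ u → A u w) (subst (n ∸ j ≤_) (countV≡count (λ u → A u w)) n∸j≤indeg)

    ∉X⇒indeg-≤ : ∀ w → T (not (X w)) → indeg G w ≤ b + count (not ∘ S)
    ∉X⇒indeg-≤ w w∉X = begin
      indeg G w                                           ≡⟨ countV≡count (λ u → A u w) ⟩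
      count (λ u → A u w)                                 ≤⟨ count-≤-+ _ _ _ (λ u → T-∧-or-notˡ (S u) (A u w)) ⟩
      count (λ u → S u ∧ A u w) + count (not ∘ S)         ≤⟨ +-monoˡ-≤ _ (sparse w w∉X) ⟩
      b + count (not ∘ S)                                 ∎
      where open ≤-Reasoning

    outdeg≤X+arcsOut : ∀ u → outdeg G u ≤ count X + count (λ w → not (X w) ∧ A u w)
    outdeg≤X+arcsOut u = begin
      outdeg G u              ≡⟨ countV≡count (A u) ⟩
      count (A u)             ≤⟨ count-≤-+ _ _ _ (λ w → T-or-not-∧ (X w) (A u w)) ⟩
      count X + count (λ w → not (X w) ∧ A u w) ∎
      where open ≤-Reasoning

    outdeg-≥⇒arcsOut : ∀ {i} u → n ∸ i ≤ outdeg G u →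
      count (not ∘ X) ≤ count (λ w → not (X w) ∧ A u w) + i
    outdeg-≥⇒arcsOut {i} u n∸i≤outdeg = begin
      count (not ∘ X)                                     ≤⟨ count-≤-+ _ _ _ (λ w → T-∧-or-not (not (X w)) (A u w)) ⟩
      count (λ w → not (X w) ∧ A u w) + count (not ∘ A u) ≤⟨ +-monoʳ-≤ _ non-out≤i ⟩
      count (λ w → not (X w) ∧ A u w) + i                 ∎
      where
      open ≤-Reasoning
      non-out≤i : count (not ∘ A u) ≤ i
      non-out≤i = count-not-≤ (A u) (subst (n ∸ i ≤_) (countV≡count (A u)) n∸i≤outdeg)

  module Core {n} (G : Digraph n) (S X : Fin n → Bool) {a b h g e : ℕ}
    (a≡b+1+h : a ≡ b + suc h) (e≡a+b+g : e ≡ a + b + g) (1≤g : 1 ≤ g)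
    (nb<g[1+h] : n * b < g * suc h)
    (sparse : ∀ w → T (not (X w)) → count (λ u → S u ∧ adj G u w) ≤ b) where

    open Sparse G S X b sparse

    private
      A : Fin n → Fin n → Bool
      A = adj G
      arcsOut : Fin n → ℕ
      arcsOut u = count (λ w → not (X w) ∧ A u w)

      b<a : b < a
      b<a = subst (b <_) (sym a≡b+1+h) (m<m+n b (s≤s z≤n))

      h≤a : h ≤ a
      h≤a = subst (h ≤_) (sym a≡b+1+h) (≤-trans (n≤1+n h) (m≤n+m (suc h) b))

      few-sources : ∀ (R : Fin n → Bool) {c} → (∀ u → T (R u) → T (S u)) →
        (∀ u → T (R u) → c ≤ arcsOut u) → count R * c ≤ n * b
      few-sources R R⊆S c≤arcs = double-count A R (not ∘ X)
        (λ w w∉X → ≤-trans (count-mono (λ u → T-∧-monoˡ (R⊆S u))) (sparse w w∉X)) c≤arcs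

    module _ (X-small : count X ≤ count S + b) where

      ¬DegreeCondition-lower : ∀ j → count S ≡ j + a → 1 ≤ j → j < n → ¬ DegreeCondition G e j
      ¬DegreeCondition-lower j S≡j+a 1≤j j<n (inj₁ j+e≤d⁺) =
        <⇒≱ (nth-sortedValues-< (outdeg G) 1≤j j≤low) j+e≤d⁺
        where
        open ≤-Reasoning
        low bad : Fin n → Bool
        low u = outdeg G u <ᵇ j + e
        bad u = not (low u) ∧ S u

        g≤arcsOut : ∀ u → T (bad u) → g ≤ arcsOut u
        g≤arcsOut u bad-u = +-cancelˡ-≤ (j + a + b) g (arcsOut u) (begin
          j + a + b + g        ≡⟨ regroup j a b g ⟩
          j + (a + b + g)      ≡⟨ cong (j +_) e≡a+b+g ⟨
          j + e                ≤⟨ ¬<ᵇ⇒≥ (proj₁ (Equivalence.to T-∧ bad-u)) ⟩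
          outdeg G u           ≤⟨ outdeg≤X+arcsOut u ⟩
          count X + arcsOut u  ≤⟨ +-monoˡ-≤ (arcsOut u) X-small ⟩
          count S + b + arcsOut u ≡⟨ cong (λ s → s + b + arcsOut u) S≡j+a ⟩
          j + a + b + arcsOut u ∎)
          where
          regroup : ∀ j a b g → j + a + b + g ≡ j + (a + b + g)
          regroup = solve-∀

        bad≤h : count bad ≤ h
        bad≤h = s≤s⁻¹ (*-cancelʳ-< g (count bad) (suc h) (begin-strict
          count bad * g  ≤⟨ few-sources bad (λ u → proj₂ ∘ Equivalence.to T-∧) g≤arcsOut ⟩
          n * b          <⟨ nb<g[1+h] ⟩
          g * suc h      ≡⟨ *-comm g (suc h) ⟩
          suc h * g      ∎))

        j≤low : j ≤ count low
        j≤low = +-cancelʳ-≤ a j (count low) (begin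
          j + a                   ≡⟨ S≡j+a ⟨
          count S                 ≤⟨ count-≤-+ S low bad (λ u → T-or-not-∧ (low u) (S u)) ⟩
          count low + count bad   ≤⟨ +-monoʳ-≤ (count low) (≤-trans bad≤h h≤a) ⟩
          count low + a           ∎)
      ¬DegreeCondition-lower j S≡j+a 1≤j j<n (inj₂ (k , k+j+e≤n , n∸j≤d⁻)) = <⇒≱ n<k+j+e k+j+e≤n
        where
        open ≤-Reasoning
        high : Fin n → Bool
        high w = not (indeg G w <ᵇ n ∸ j)

        j+b<S : j + suc b ≤ count S
        j+b<S = ≤-trans (+-monoʳ-≤ j b<a) (≤-reflexive (sym S≡j+a))

        n<k+j+e : n < k + j + e
        n<k+j+e = begin-strict
          n                       <⟨ nth-sortedValues-≥ (indeg G) k (m<n⇒0<n∸m j<n) n∸j≤d⁻ ⟩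
          k + count high          ≤⟨ +-monoʳ-≤ k (count-mono (λ w → indeg-≥⇒∈X w j+b<S ∘ ¬<ᵇ⇒≥)) ⟩
          k + count X             ≤⟨ +-monoʳ-≤ k X-small ⟩
          k + (count S + b)       ≡⟨ cong (λ s → k + (s + b)) S≡j+a ⟩
          k + (j + a + b)         ≤⟨ m≤m+n (k + (j + a + b)) g ⟩
          k + (j + a + b) + g     ≡⟨ regroup k j a b g ⟩
          k + j + (a + b + g)     ≡⟨ cong (k + j +_) e≡a+b+g ⟨
          k + j + e               ∎
          where
          regroup : ∀ k j a b g → k + (j + a + b) + g ≡ k + j + (a + b + g)
          regroup = solve-∀

      ¬DegreeCondition-upper : ∀ i → n ≡ count S + a + i → 1 ≤ i → i < n → ¬ DegreeCondition (transpose G) e i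
      ¬DegreeCondition-upper i n≡S+a+i 1≤i i<n = refute
        where
        open ≤-Reasoning

        ∁S≡a+i : count (not ∘ S) ≡ a + i
        ∁S≡a+i = +-cancelˡ-≡ (count S) _ _ (begin-equality
          count S + count (not ∘ S)  ≡⟨ count+count-not S ⟩
          n                          ≡⟨ n≡S+a+i ⟩
          count S + a + i            ≡⟨ +-assoc (count S) a i ⟩
          count S + (a + i)          ∎)

        a+i≤b+∁X : a + i ≤ b + count (not ∘ X)
        a+i≤b+∁X = +-cancelˡ-≤ (count S) _ _ (begin
          count S + (a + i)          ≡⟨ trans n≡S+a+i (+-assoc (count S) a i) ⟨
          n                          ≡⟨ count+count-not X ⟨
          count X + count (not ∘ X)  ≤⟨ +-monoˡ-≤ _ X-small ⟩
          count S + b + count (not ∘ X) ≡⟨ +-assoc (count S) b _ ⟩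
          count S + (b + count (not ∘ X)) ∎)

        lower : i + e ≤ d⁻ G (ℤ.+ i) → ⊥
        lower i+e≤d⁻ = <⇒≱ (nth-sortedValues-< (indeg G) 1≤i i≤low) i+e≤d⁻
          where
          low : Fin n → Bool
          low w = indeg G w <ᵇ i + e
          ∉X⇒low : ∀ w → T (not (X w)) → T (low w)
          ∉X⇒low w w∉X = <⇒<ᵇ (begin-strict
            indeg G w                  ≤⟨ ∉X⇒indeg-≤ w w∉X ⟩
            b + count (not ∘ S)        ≡⟨ cong (b +_) ∁S≡a+i ⟩
            b + (a + i)                <⟨ m<m+n (b + (a + i)) 1≤g ⟩
            b + (a + i) + g            ≡⟨ regroup a b g i ⟩
            i + (a + b + g)            ≡⟨ cong (i +_) e≡a+b+g ⟨
            i + e                      ∎)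
            where
            regroup : ∀ a b g i → b + (a + i) + g ≡ i + (a + b + g)
            regroup = solve-∀
          i≤low : i ≤ count low
          i≤low = ≤-trans (+-cancelˡ-≤ b i _ (≤-trans (+-monoˡ-≤ i (<⇒≤ b<a)) a+i≤b+∁X)) (count-mono ∉X⇒low)

        upper : Σ ℕ (λ k → k + i + e ≤ n × n ∸ i ≤ d⁺ G (ℤ.+ k)) → ⊥
        upper (k , k+i+e≤n , n∸i≤d⁺) = <⇒≱ Sb<g g≤Sb
          where
          high Sb : Fin n → Bool
          high u = not (outdeg G u <ᵇ n ∸ i)
          Sb u = high u ∧ S u

          g≤Sb : g ≤ count Sb
          g≤Sb = ≤-trans (m≤n+m g b) (<⇒≤ (+-cancelˡ-< (k + i + a) (b + g) (count Sb) (begin-strict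
            k + i + a + (b + g)        ≡⟨ regroupₗ k i a b g ⟩
            k + i + (a + b + g)        ≡⟨ cong (k + i +_) e≡a+b+g ⟨
            k + i + e                  ≤⟨ k+i+e≤n ⟩
            n                          <⟨ nth-sortedValues-≥ (outdeg G) k (m<n⇒0<n∸m i<n) n∸i≤d⁺ ⟩
            k + count high             ≤⟨ +-monoʳ-≤ k (count-≤-+ high Sb (not ∘ S) (λ u → T-∧-or-not (high u) (S u))) ⟩
            k + (count Sb + count (not ∘ S)) ≡⟨ cong (λ s → k + (count Sb + s)) ∁S≡a+i ⟩
            k + (count Sb + (a + i))   ≡⟨ regroupᵣ k i a (count Sb) ⟩
            k + i + a + count Sb       ∎)))
            where
            regroupₗ : ∀ k i a b g → k + i + a + (b + g) ≡ k + i + (a + b + g)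
            regroupₗ = solve-∀
            regroupᵣ : ∀ k i a s → k + (s + (a + i)) ≡ k + i + a + s
            regroupᵣ = solve-∀

          1+h≤arcsOut : ∀ u → T (Sb u) → suc h ≤ arcsOut u
          1+h≤arcsOut u Sb-u = +-cancelˡ-≤ b _ _ (+-cancelʳ-≤ i _ _ (begin
            b + suc h + i              ≡⟨ cong (_+ i) a≡b+1+h ⟨
            a + i                      ≤⟨ a+i≤b+∁X ⟩
            b + count (not ∘ X)        ≤⟨ +-monoʳ-≤ b (outdeg-≥⇒arcsOut u (¬<ᵇ⇒≥ (proj₁ (Equivalence.to T-∧ Sb-u)))) ⟩
            b + (arcsOut u + i)        ≡⟨ +-assoc b (arcsOut u) i ⟨
            b + arcsOut u + i          ∎))

          Sb<g : count Sb < g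
          Sb<g = *-cancelʳ-< (suc h) (count Sb) g (begin-strict
            count Sb * suc h           ≤⟨ few-sources Sb (λ u → proj₂ ∘ Equivalence.to T-∧) 1+h≤arcsOut ⟩
            n * b                      <⟨ nb<g[1+h] ⟩
            g * suc h                  ∎)

        refute : ¬ DegreeCondition (transpose G) e i
        refute (inj₁ i+e≤d⁻) = lower i+e≤d⁻
        refute (inj₂ shifted) = upper shifted

    expands : a < count S → count S + a < n →
      (∀ i → 1 ≤ i → 2 * i < n → DegreeCondition G e i × DegreeCondition (transpose G) e i) →
      count S + b < count X
    expands a<S S+a<n conditions = ≰⇒> deficient
      where
      j i : ℕ
      j = count S ∸ a
      i = n ∸ (count S + a)
      S≡j+a : count S ≡ j + a
      S≡j+a = sym (m∸n+n≡m (<⇒≤ a<S))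
      n≡S+a+i : n ≡ count S + a + i
      n≡S+a+i = sym (m+[n∸m]≡n (<⇒≤ S+a<n))
      deficient : count X ≤ count S + b → ⊥
      deficient X-small with 2 * j <? n
      ... | yes 2j<n = ¬DegreeCondition-lower X-small j S≡j+a (m<n⇒0<n∸m a<S) (2*m<n⇒m<n 2j<n)
                         (proj₁ (conditions j (m<n⇒0<n∸m a<S) 2j<n))
      ... | no  2j≮n = ¬DegreeCondition-upper X-small i n≡S+a+i (m<n⇒0<n∸m S+a<n) (2*m<n⇒m<n 2i<n)
                         (proj₂ (conditions i (m<n⇒0<n∸m S+a<n) 2i<n))
        where
        n≡j+a+a+i : n ≡ j + a + a + i
        n≡j+a+a+i = trans n≡S+a+i (cong (λ s → s + a + i) S≡j+a)
        2i<n : 2 * i < n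
        2i<n = subst (2 * i <_) (sym n≡j+a+a+i)
          (2*i<j+a+a+i {i} {j} (≤-trans (s≤s z≤n) b<a) (subst (_≤ 2 * j) n≡j+a+a+i (≮⇒≥ 2j≮n)))

  module _ {n} (G : Digraph n) where

    d⁺₁≤outdeg : ∀ v → d⁺ G (ℤ.+ 1) ≤ outdeg G v
    d⁺₁≤outdeg v = s≤s⁻¹ (nth-sortedValues-< (outdeg G) (s≤s z≤n)
      (1≤count (λ u → outdeg G u <ᵇ suc (outdeg G v)) (<⇒<ᵇ (n<1+n (outdeg G v)))))

    -- At most one vertex is not an in-neighbour of w, and w itself is one since G is loopless.
    indeg-≥n∸1⇒out-neighbour : ∀ v w → n ∸ 1 ≤ indeg G w → T (adj G v w) ⊎ T (does (w ≟ v))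
    indeg-≥n∸1⇒out-neighbour v w n∸1≤indeg with adj G v w in v→w | w ≟ v
    ... | true  | _       = inj₁ tt
    ... | false | yes _   = inj₂ tt
    ... | false | no w≢v  = contradiction
      (2≤count (λ u → not (adj G u w)) (w≢v ∘ sym) (subst (T ∘ not) (sym v→w) tt) (subst (T ∘ not) (sym (loopless G w)) tt))
      (<⇒≱ (s≤s (count-not-≤ (λ u → adj G u w) (subst (n ∸ 1 ≤_) (countV≡count (λ u → adj G u w)) n∸1≤indeg))))

    1+e≤outdeg : ∀ {e} → 2 ≤ n → DegreeCondition G e 1 → ∀ v → suc e ≤ outdeg G v
    1+e≤outdeg 2≤n (inj₁ 1+e≤d⁺₁) v = ≤-trans 1+e≤d⁺₁ (d⁺₁≤outdeg v)
    1+e≤outdeg {e} 2≤n (inj₂ (k , k+1+e≤n , n∸1≤d⁻)) v = +-cancelˡ-≤ k (suc e) (outdeg G v) (begin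
      k + suc e                ≡⟨ +-assoc k 1 e ⟨
      k + 1 + e              ≤⟨ k+1+e≤n ⟩
      n                          ≤⟨ s≤s⁻¹ (begin-strict
        n                          <⟨ nth-sortedValues-≥ (indeg G) k (m<n⇒0<n∸m 2≤n) n∸1≤d⁻ ⟩
        k + count full           ≤⟨ +-monoʳ-≤ k full≤outdeg+1 ⟩
        k + (outdeg G v + 1)   ≡⟨ trans (cong (k +_) (+-comm (outdeg G v) 1)) (+-suc k (outdeg G v)) ⟩
        suc (k + outdeg G v)     ∎) ⟩
      k + outdeg G v           ∎)
      where
      open ≤-Reasoning
      full : Fin n → Bool
      full w = not (indeg G w <ᵇ n ∸ 1)
      full≤outdeg+1 : count full ≤ outdeg G v + 1
      full≤outdeg+1 = begin
        count full                                     ≤⟨ count-≤-+ full (adj G v) (λ w → does (w ≟ v))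
                                                            (λ w → indeg-≥n∸1⇒out-neighbour v w ∘ ¬<ᵇ⇒≥) ⟩
        count (adj G v) + count (λ w → does (w ≟ v)) ≡⟨ cong₂ _+_ (sym (countV≡count (adj G v))) (count-≟ v) ⟩
        outdeg G v + 1                               ∎

module Rationals where

  open import Data.Integer as ℤ using (ℤ)
  import Data.Integer.DivMod as ℤD
  import Data.Integer.Properties as ℤP
  open import Data.Nat as ℕ using (ℕ; suc)
  open import Data.Nat.Coprimality using (Coprime; 1-coprimeTo) renaming (sym to coprime-sym)
  import Data.Nat.Properties as ℕP
  open import Data.Rational as ℚ using (ℚ; mkℚ; floor; toℚᵘ; _+_; _-_; _*_; -_; _≤_; _<_)
  import Data.Rational.Properties as ℚP
  import Data.Rational.Unnormalised as ℚᵘ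
  import Data.Rational.Unnormalised.Properties as ℚᵘP
  open import Relation.Binary.PropositionalEquality

  ⟦⟧≡mkℚ : ∀ m → ⟦ m ⟧ ≡ mkℚ (ℤ.+ m) 0 (coprime-sym (1-coprimeTo m))
  ⟦⟧≡mkℚ m = ℚP.normalize-coprime (coprime-sym (1-coprimeTo m))

  ⟦⟧-mono-≤ : ∀ {m n} → m ℕ.≤ n → ⟦ m ⟧ ≤ ⟦ n ⟧
  ⟦⟧-mono-≤ {m} {n} m≤n rewrite ⟦⟧≡mkℚ m | ⟦⟧≡mkℚ n =
    ℚ.*≤* (subst₂ ℤ._≤_ (sym (ℤP.*-identityʳ (ℤ.+ m))) (sym (ℤP.*-identityʳ (ℤ.+ n))) (ℤ.+≤+ m≤n))

  ⟦⟧-cancel-≤ : ∀ {m n} → ⟦ m ⟧ ≤ ⟦ n ⟧ → m ℕ.≤ n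
  ⟦⟧-cancel-≤ {m} {n} m≤n rewrite ⟦⟧≡mkℚ m | ⟦⟧≡mkℚ n with m≤n
  ... | ℚ.*≤* m≤n = ℤP.drop‿+≤+ (subst₂ ℤ._≤_ (ℤP.*-identityʳ (ℤ.+ m)) (ℤP.*-identityʳ (ℤ.+ n)) m≤n)

  ⟦⟧-cancel-< : ∀ {m n} → ⟦ m ⟧ < ⟦ n ⟧ → m ℕ.< n
  ⟦⟧-cancel-< {m} {n} m<n rewrite ⟦⟧≡mkℚ m | ⟦⟧≡mkℚ n with m<n
  ... | ℚ.*<* m<n = ℤP.drop‿+<+ (subst₂ ℤ._<_ (ℤP.*-identityʳ (ℤ.+ m)) (ℤP.*-identityʳ (ℤ.+ n)) m<n)

  ⟦⟧-homo-+ : ∀ m n → ⟦ m ℕ.+ n ⟧ ≡ ⟦ m ⟧ + ⟦ n ⟧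
  ⟦⟧-homo-+ m n rewrite ⟦⟧≡mkℚ m | ⟦⟧≡mkℚ n = ℚP./-cong {ℤ.+ (m ℕ.+ n)} {1} (sym numerators) refl
    where
    numerators : ℤ.+ m ℤ.* ℤ.+ 1 ℤ.+ ℤ.+ n ℤ.* ℤ.+ 1 ≡ ℤ.+ (m ℕ.+ n)
    numerators = trans (cong₂ ℤ._+_ (ℤP.*-identityʳ (ℤ.+ m)) (ℤP.*-identityʳ (ℤ.+ n))) (sym (ℤP.pos-+ m n))

  floor≡⇒≤ : ∀ y {k} → floor y ≡ ℤ.+ k → ⟦ k ⟧ ≤ y
  floor≡⇒≤ (mkℚ num d _) {k} ⌊y⌋≡k rewrite ⟦⟧≡mkℚ k =
    ℚ.*≤* (subst₂ ℤ._≤_ (cong (ℤ._* ℤ.+ suc d) ⌊y⌋≡k) (sym (ℤP.*-identityʳ num)) (ℤD.[n/d]*d≤n num (ℤ.+ suc d)))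

  -+-cancel : ∀ y z → y - z + z ≡ y
  -+-cancel y z = trans (ℚP.+-assoc y (- z) z) (trans (cong (y +_) (ℚP.+-inverseˡ z)) (ℚP.+-identityʳ y))

  ≤-⇒+≤ : ∀ {x y z} → x ≤ y - z → x + z ≤ y
  ≤-⇒+≤ {x} {y} {z} x≤y-z = subst (x + z ≤_) (-+-cancel y z) (ℚP.+-monoˡ-≤ z x≤y-z)

  <-⇒+< : ∀ {x y z} → x < y - z → x + z < y
  <-⇒+< {x} {y} {z} x<y-z = subst (x + z <_) (-+-cancel y z) (ℚP.+-monoˡ-< z x<y-z)

  1-*-distrib : ∀ t w → (ℚ.1ℚ - t) * w ≡ w - t * w
  1-*-distrib t w = trans (ℚP.*-distribʳ-+ w ℚ.1ℚ (- t))
    (cong₂ _+_ (ℚP.*-identityˡ w) (sym (ℚP.neg-distribˡ-* t w)))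

  module Fraction (P d : ℕ) .(c : Coprime P (suc d)) where

    r : ℚ
    r = mkℚ (ℤ.+ P) d c

    private
      toℚᵘ-r*⟦⟧ : ∀ n → toℚᵘ (r * ⟦ n ⟧) ℚᵘ.≃ ℚᵘ.mkℚᵘ (ℤ.+ P ℤ.* ℤ.+ n) (d ℕ.* 1)
      toℚᵘ-r*⟦⟧ n rewrite ⟦⟧≡mkℚ n = ℚP.toℚᵘ-homo-* r (mkℚ (ℤ.+ n) 0 (coprime-sym (1-coprimeTo n)))

      denominator : ∀ m → ℤ.+ m ℤ.* ℤ.+ suc (d ℕ.* 1) ≡ ℤ.+ (m ℕ.* suc d)
      denominator m = trans (sym (ℤP.pos-* m (suc (d ℕ.* 1)))) (cong (λ k → ℤ.+ (m ℕ.* suc k)) (ℕP.*-identityʳ d))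

      numerator : ∀ n → ℤ.+ P ℤ.* ℤ.+ n ℤ.* ℤ.+ 1 ≡ ℤ.+ (P ℕ.* n)
      numerator n = trans (ℤP.*-identityʳ _) (sym (ℤP.pos-* P n))

    ⟦⟧≤r*⟦⟧ : ∀ m n → m ℕ.* suc d ℕ.≤ P ℕ.* n → ⟦ m ⟧ ≤ r * ⟦ n ⟧
    ⟦⟧≤r*⟦⟧ m n mQ≤Pn = ℚP.toℚᵘ-cancel-≤ (ℚᵘP.≤-respʳ-≃ (ℚᵘP.≃-sym (toℚᵘ-r*⟦⟧ n)) unnormalised)
      where
      unnormalised : toℚᵘ ⟦ m ⟧ ℚᵘ.≤ ℚᵘ.mkℚᵘ (ℤ.+ P ℤ.* ℤ.+ n) (d ℕ.* 1)
      unnormalised rewrite ⟦⟧≡mkℚ m = ℚᵘ.*≤* (subst₂ ℤ._≤_ (sym (denominator m)) (sym (numerator n)) (ℤ.+≤+ mQ≤Pn))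

    r*⟦⟧≤⟦⟧ : ∀ m n → P ℕ.* n ℕ.≤ m ℕ.* suc d → r * ⟦ n ⟧ ≤ ⟦ m ⟧
    r*⟦⟧≤⟦⟧ m n Pn≤mQ = ℚP.toℚᵘ-cancel-≤ (ℚᵘP.≤-respˡ-≃ (ℚᵘP.≃-sym (toℚᵘ-r*⟦⟧ n)) unnormalised)
      where
      unnormalised : ℚᵘ.mkℚᵘ (ℤ.+ P ℤ.* ℤ.+ n) (d ℕ.* 1) ℚᵘ.≤ toℚᵘ ⟦ m ⟧
      unnormalised rewrite ⟦⟧≡mkℚ m = ℚᵘ.*≤* (subst₂ ℤ._≤_ (sym (numerator n)) (sym (denominator m)) (ℤ.+≤+ Pn≤mQ))

module Arithmetic where

  open import Data.Nat
  open import Data.Nat.DivMod using (m≡m%n+[m/n]*n; m%n<n)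
  open import Data.Nat.Properties
  open import Data.Nat.Tactic.RingSolver using (solve-∀)
  open import Relation.Binary.PropositionalEquality
  open import Relation.Nullary using (contradiction)

  module Constants {q a b e n : ℕ} .{{_ : NonZero q}}
    (8qa≤n : 8 * q * a ≤ n) (8qb≤1+a : 8 * q * b ≤ suc a) (2≤a : 2 ≤ a)
    (16q≤n : 16 * q ≤ n) (n<[1+e]q : n < suc e * q) where

    open ≤-Reasoning

    private
      8x≤8qx : ∀ x → 8 * x ≤ 8 * q * x
      8x≤8qx x = *-monoˡ-≤ x (m≤m*n 8 q)

      1≤n : 1 ≤ n
      1≤n = ≤-trans (≤-trans (>-nonZero⁻¹ q) (m≤n*m q 16)) 16q≤n

      a≤n : a ≤ n
      a≤n = ≤-trans (m≤n*m a 8) (≤-trans (8x≤8qx a) 8qa≤n)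

      4b≤a : 4 * b ≤ a
      4b≤a = *-cancelˡ-≤ 2 (begin
        2 * (4 * b)  ≡⟨ *-assoc 2 4 b ⟨
        8 * b        ≤⟨ 8x≤8qx b ⟩
        8 * q * b    ≤⟨ 8qb≤1+a ⟩
        suc a        ≡⟨ +-comm 1 a ⟩
        a + 1        ≤⟨ +-monoʳ-≤ a (≤-trans (s≤s z≤n) 2≤a) ⟩
        a + a        ≡⟨ cong (a +_) (+-identityʳ a) ⟨
        2 * a        ∎)

      b+1≤a : b + 1 ≤ a
      b+1≤a = *-cancelˡ-≤ 4 (begin
        4 * (b + 1)  ≡⟨ *-distribˡ-+ 4 b 1 ⟩
        4 * b + 4    ≤⟨ +-mono-≤ 4b≤a (≤-trans (s≤s (s≤s (s≤s (s≤s z≤n)))) (*-monoʳ-≤ 3 2≤a)) ⟩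
        a + 3 * a    ≡⟨⟩
        4 * a        ∎)

      2q[a+b+1]≤n+2 : 2 * q * (a + b + 1) ≤ n + 2
      2q[a+b+1]≤n+2 = *-cancelˡ-≤ 8 (begin
        8 * (2 * q * (a + b + 1))       ≡⟨ regroup q a b ⟩
        2 * (8 * q * a) + 2 * (8 * q * b) + 16 * q
          ≤⟨ +-mono-≤ (+-mono-≤ (*-monoʳ-≤ 2 8qa≤n) (*-monoʳ-≤ 2 8qb≤n+1)) 16q≤n ⟩
        2 * n + 2 * (n + 1) + n         ≤⟨ m≤m+n _ (3 * n + 14) ⟩
        2 * n + 2 * (n + 1) + n + (3 * n + 14) ≡⟨ simplify n ⟩
        8 * (n + 2)                     ∎)
        where
        8qb≤n+1 : 8 * q * b ≤ n + 1
        8qb≤n+1 = ≤-trans 8qb≤1+a (≤-trans (≤-reflexive (+-comm 1 a)) (+-monoˡ-≤ 1 a≤n))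
        simplify : ∀ n → 2 * n + 2 * (n + 1) + n + (3 * n + 14) ≡ 8 * (n + 2)
        simplify = solve-∀
        regroup : ∀ q a b → 8 * (2 * q * (a + b + 1)) ≡ 2 * (8 * q * a) + 2 * (8 * q * b) + 16 * q
        regroup = solve-∀

      n+2q[a+b]≤2qe : n + 2 * q * (a + b) ≤ 2 * q * e
      n+2q[a+b]≤2qe = +-cancelʳ-≤ (2 * q) _ _ (begin
        n + 2 * q * (a + b) + 2 * q     ≡⟨ regroup n q a b ⟩
        n + 2 * q * (a + b + 1)         ≤⟨ +-monoʳ-≤ n 2q[a+b+1]≤n+2 ⟩
        n + (n + 2)                     ≡⟨ double n ⟩
        2 * suc n                       ≤⟨ *-monoʳ-≤ 2 n<[1+e]q ⟩
        2 * (suc e * q)                 ≡⟨ expand e q ⟩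
        2 * q * e + 2 * q               ∎)
        where
        double : ∀ n → n + (n + 2) ≡ 2 * suc n
        double = solve-∀
        expand : ∀ e q → 2 * (suc e * q) ≡ 2 * q * e + 2 * q
        expand = solve-∀
        regroup : ∀ n q a b → n + 2 * q * (a + b) + 2 * q ≡ n + 2 * q * (a + b + 1)
        regroup = solve-∀

      a+b≤e : a + b ≤ e
      a+b≤e = *-cancelˡ-≤ (2 * q) {{m*n≢0 2 q}} (≤-trans (m≤n+m _ n) n+2q[a+b]≤2qe)

    g h : ℕ
    g = e ∸ (a + b)
    h = a ∸ (b + 1)

    e≡a+b+g : e ≡ a + b + g
    e≡a+b+g = sym (m+[n∸m]≡n a+b≤e)

    a≡b+1+h : a ≡ b + suc h
    a≡b+1+h = trans (sym (m+[n∸m]≡n b+1≤a)) (+-assoc b 1 h)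

    n≤2qg : n ≤ 2 * q * g
    n≤2qg = +-cancelʳ-≤ (2 * q * (a + b)) n (2 * q * g) (begin
      n + 2 * q * (a + b)             ≤⟨ n+2q[a+b]≤2qe ⟩
      2 * q * e                       ≡⟨ cong (2 * q *_) e≡a+b+g ⟩
      2 * q * (a + b + g)             ≡⟨ *-distribˡ-+ (2 * q) (a + b) g ⟩
      2 * q * (a + b) + 2 * q * g     ≡⟨ +-comm (2 * q * (a + b)) _ ⟩
      2 * q * g + 2 * q * (a + b)     ∎)

    1≤g : 1 ≤ g
    1≤g = ≰⇒> λ g≤0 → contradiction
      (≤-trans 1≤n (≤-trans n≤2qg (≤-trans (*-monoʳ-≤ (2 * q) g≤0) (≤-reflexive (*-zeroʳ (2 * q)))))) λ ()

    nb<g[1+h] : n * b < g * suc h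
    nb<g[1+h] = *-cancelˡ-< (8 * q) (n * b) (g * suc h) (begin-strict
      8 * q * (n * b)         ≡⟨ *-comm (8 * q) (n * b) ⟩
      n * b * (8 * q)         ≡⟨ *-assoc n b (8 * q) ⟩
      n * (b * (8 * q))       ≡⟨ cong (n *_) (*-comm b (8 * q)) ⟩
      n * (8 * q * b)         ≤⟨ *-monoʳ-≤ n 8qb≤1+a ⟩
      n * suc a               <⟨ *-monoʳ-< n {{>-nonZero 1≤n}} 1+a<3a ⟩
      n * (3 * a)             ≤⟨ *-monoʳ-≤ n 3a≤4[1+h] ⟩
      n * (4 * suc h)         ≤⟨ *-monoˡ-≤ (4 * suc h) n≤2qg ⟩
      2 * q * g * (4 * suc h) ≡⟨ regroup q g (suc h) ⟩
      8 * q * (g * suc h)     ∎)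
      where
      regroup : ∀ q g k → 2 * q * g * (4 * k) ≡ 8 * q * (g * k)
      regroup = solve-∀
      1+a<3a : suc a < 3 * a
      1+a<3a = begin-strict
        suc a         ≡⟨ +-comm 1 a ⟩
        a + 1         <⟨ +-monoʳ-< a ≤-refl ⟩
        a + 2         ≤⟨ +-monoʳ-≤ a (≤-trans 2≤a (m≤m+n a (a + 0))) ⟩
        a + (a + (a + 0)) ≡⟨⟩
        3 * a         ∎
      3a≤4[1+h] : 3 * a ≤ 4 * suc h
      3a≤4[1+h] = +-cancelʳ-≤ a _ _ (begin
        3 * a + a             ≡⟨ +-comm (3 * a) a ⟩
        4 * a                 ≡⟨ cong (4 *_) a≡b+1+h ⟩
        4 * (b + suc h)       ≡⟨ *-distribˡ-+ 4 b (suc h) ⟩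
        4 * b + 4 * suc h     ≤⟨ +-monoˡ-≤ (4 * suc h) 4b≤a ⟩
        a + 4 * suc h         ≡⟨ +-comm a _ ⟩
        4 * suc h + a         ∎)

  scale-floor : ∀ {k U V x y} .{{_ : NonZero V}} → k * U ≤ V → x * V ≤ U * y → k * x ≤ y
  scale-floor {k} {U} {V} {x} {y} kU≤V xV≤Uy = *-cancelʳ-≤ (k * x) y V (begin
    k * x * V    ≡⟨ *-assoc k x V ⟩
    k * (x * V)  ≤⟨ *-monoʳ-≤ k xV≤Uy ⟩
    k * (U * y)  ≡⟨ *-assoc k U y ⟨
    k * U * y    ≤⟨ *-monoˡ-≤ y kU≤V ⟩
    V * y        ≡⟨ *-comm V y ⟩
    y * V        ∎)
    where open ≤-Reasoning

  m<[1+m/n]*n : ∀ m n .{{_ : NonZero n}} → m < suc (m / n) * n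
  m<[1+m/n]*n m n = subst (_< suc (m / n) * n) (sym (m≡m%n+[m/n]*n m n)) (+-monoˡ-< (m / n * n) (m%n<n m n))

module Rounding where

  open Expansion
  open OrderStatistics
  open Rationals
  open import Data.Integer as ℤ using (ℤ)
  open import Data.Nat as ℕ using (ℕ; _∸_)
  import Data.Nat.Properties as ℕP
  open import Algebra.Properties.CommutativeSemigroup ℕP.+-commutativeSemigroup using (xy∙z≈xz∙y)
  open import Data.Product using (_,_)
  open import Data.Rational using (_+_; _*_; _≤_)
  import Data.Rational.Properties as ℚP
  open import Data.Sum using (inj₁; inj₂)
  open import Relation.Binary.PropositionalEquality

  degreeCondition : ∀ {n} (G : Digraph n) {η e i} → ⟦ e ⟧ ≤ η * ⟦ n ⟧ → i ℕ.< n →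
    CondI G η i → DegreeCondition G e i
  degreeCondition {n} G {η} {e} {i} e≤ηn i<n (inj₁ i+ηn≤d⁺) = inj₁ (⟦⟧-cancel-≤ (begin
    ⟦ i ℕ.+ e ⟧         ≡⟨ ⟦⟧-homo-+ i e ⟩
    ⟦ i ⟧ + ⟦ e ⟧       ≤⟨ ℚP.+-monoʳ-≤ ⟦ i ⟧ e≤ηn ⟩
    ⟦ i ⟧ + η * ⟦ n ⟧   ≤⟨ i+ηn≤d⁺ ⟩
    ⟦ d⁺ G (ℤ.+ i) ⟧    ∎))
    where open ℚP.≤-Reasoning
  degreeCondition {n} G {η} {e} {i} e≤ηn i<n (inj₂ n∸i≤d⁻)
    with nth-pos (sortedValues (indeg G)) (shiftIdx n i η) (ℕP.≤-trans (ℕP.m<n⇒0<n∸m i<n) n∸i≤d⁻)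
  ... | k , shift≡k = inj₂ (k , k+i+e≤n , subst (λ z → n ∸ i ℕ.≤ d⁻ G z) shift≡k n∸i≤d⁻)
    where
    open ℚP.≤-Reasoning
    k+e+i≤n : ⟦ k ℕ.+ e ℕ.+ i ⟧ ≤ ⟦ n ⟧
    k+e+i≤n = begin
      ⟦ k ℕ.+ e ℕ.+ i ⟧          ≡⟨ trans (⟦⟧-homo-+ (k ℕ.+ e) i) (cong (_+ ⟦ i ⟧) (⟦⟧-homo-+ k e)) ⟩
      ⟦ k ⟧ + ⟦ e ⟧ + ⟦ i ⟧      ≤⟨ ℚP.+-monoˡ-≤ ⟦ i ⟧ (ℚP.+-monoʳ-≤ ⟦ k ⟧ e≤ηn) ⟩
      ⟦ k ⟧ + η * ⟦ n ⟧ + ⟦ i ⟧  ≤⟨ ≤-⇒+≤ (≤-⇒+≤ (floor≡⇒≤ _ shift≡k)) ⟩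
      ⟦ n ⟧                      ∎
    k+i+e≤n : k ℕ.+ i ℕ.+ e ℕ.≤ n
    k+i+e≤n = subst (ℕ._≤ n) (xy∙z≈xz∙y k e i) (⟦⟧-cancel-≤ k+e+i≤n)

open Counting
open Expansion
open Rationals
open Arithmetic
open Rounding
open import Data.Bool using (Bool; T; _∧_; not)
open import Data.Fin using (Fin)
open import Data.Fin.Subset using (∣_∣)
open import Data.Fin.Subset.Properties using (_∈?_)
open import Data.Integer as ℤ using (ℤ)
import Data.Integer.Properties as ℤP
open import Data.Nat as ℕ using (suc; z≤n; s≤s)
open import Data.Nat.Coprimality using (Coprime; 1-coprimeTo)
open import Data.Nat.DivMod using (m/n*n≤m)
import Data.Nat.Properties as ℕP
open import Data.Product using (_,_; proj₁; proj₂)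
open import Data.Rational using (mkℚ; _+_; _*_; _≤_; _<_)
import Data.Rational.Properties as ℚP
open import Relation.Binary.PropositionalEquality
open import Relation.Nullary using (Dec; ¬_; no)
open import Relation.Nullary.Decidable using (does)

does-false⇒¬ : ∀ {A : Set} (A? : Dec A) → T (not (does A?)) → ¬ A
does-false⇒¬ (no ¬a) _ = ¬a

module Robust (P d : ℕ) .(c : Coprime P (suc d)) (u v : ℕ) .(c′ : Coprime (suc u) (suc v))
  (1≤P : 1 ℕ.≤ P) (8QU≤V : 8 ℕ.* suc d ℕ.* suc u ℕ.≤ suc v)
  (n : ℕ) (2V≤n : 2 ℕ.* suc v ℕ.≤ n) (G : Digraph n) where

  η τ ν : ℚ
  η = mkℚ (ℤ.+ P) d c
  τ = mkℚ (ℤ.+ suc u) v c′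
  ν = τ * τ

  private
    Q U V : ℕ
    Q = suc d
    U = suc u
    V = suc v

  -- Only the floor inequalities below are used; unfolding the divisions makes type checking blow up.
  abstract
    e a b : ℕ
    e = (P ℕ.* n) ℕ./ Q
    a = (U ℕ.* n) ℕ./ V
    b = (U ℕ.* suc a) ℕ./ V

    eQ≤Pn : e ℕ.* Q ℕ.≤ P ℕ.* n
    eQ≤Pn = m/n*n≤m (P ℕ.* n) Q
    Pn<[1+e]Q : P ℕ.* n ℕ.< suc e ℕ.* Q
    Pn<[1+e]Q = m<[1+m/n]*n (P ℕ.* n) Q
    aV≤Un : a ℕ.* V ℕ.≤ U ℕ.* n
    aV≤Un = m/n*n≤m (U ℕ.* n) V
    Un<[1+a]V : U ℕ.* n ℕ.< suc a ℕ.* V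
    Un<[1+a]V = m<[1+m/n]*n (U ℕ.* n) V
    bV≤U[1+a] : b ℕ.* V ℕ.≤ U ℕ.* suc a
    bV≤U[1+a] = m/n*n≤m (U ℕ.* suc a) V
    U[1+a]<[1+b]V : U ℕ.* suc a ℕ.< suc b ℕ.* V
    U[1+a]<[1+b]V = m<[1+m/n]*n (U ℕ.* suc a) V

  e≤ηn : ⟦ e ⟧ ≤ η * ⟦ n ⟧
  e≤ηn = Fraction.⟦⟧≤r*⟦⟧ P d c e n eQ≤Pn

  a≤τn : ⟦ a ⟧ ≤ τ * ⟦ n ⟧
  a≤τn = Fraction.⟦⟧≤r*⟦⟧ U v c′ a n aV≤Un

  νn≤1+b : ν * ⟦ n ⟧ ≤ ⟦ suc b ⟧
  νn≤1+b = begin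
    τ * τ * ⟦ n ⟧    ≡⟨ ℚP.*-assoc τ τ ⟦ n ⟧ ⟩
    τ * (τ * ⟦ n ⟧)  ≤⟨ ℚP.*-monoˡ-≤-nonNeg τ (Fraction.r*⟦⟧≤⟦⟧ U v c′ (suc a) n (ℕP.<⇒≤ Un<[1+a]V)) ⟩
    τ * ⟦ suc a ⟧    ≤⟨ Fraction.r*⟦⟧≤⟦⟧ U v c′ (suc b) (suc a) (ℕP.<⇒≤ U[1+a]<[1+b]V) ⟩
    ⟦ suc b ⟧        ∎
    where open ℚP.≤-Reasoning

  private
    2≤a : 2 ℕ.≤ a
    2≤a = ℕ.s≤s⁻¹ (ℕP.*-cancelʳ-< V 2 (suc a) (begin-strict
      2 ℕ.* V          ≤⟨ 2V≤n ⟩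
      n                ≤⟨ ℕP.m≤n*m n U ⟩
      U ℕ.* n          <⟨ Un<[1+a]V ⟩
      suc a ℕ.* V      ∎))
      where open ℕP.≤-Reasoning

    16Q≤n : 16 ℕ.* Q ℕ.≤ n
    16Q≤n = begin
      16 ℕ.* Q               ≡⟨ ℕP.*-assoc 2 8 Q ⟩
      2 ℕ.* (8 ℕ.* Q)        ≤⟨ ℕP.*-monoʳ-≤ 2 (ℕP.≤-trans (ℕP.m≤m*n (8 ℕ.* Q) U) 8QU≤V) ⟩
      2 ℕ.* V                ≤⟨ 2V≤n ⟩
      n                      ∎
      where open ℕP.≤-Reasoning

    n<[1+e]Q : n ℕ.< suc e ℕ.* Q
    n<[1+e]Q = ℕP.≤-<-trans (ℕP.m≤n*m n P {{ℕ.>-nonZero 1≤P}}) Pn<[1+e]Q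

  open Constants {Q} {a} {b} {e} {n}
    (scale-floor {8 ℕ.* Q} {U} {V} {a} 8QU≤V aV≤Un)
    (scale-floor {8 ℕ.* Q} {U} {V} {b} 8QU≤V bV≤U[1+a])
    2≤a 16Q≤n n<[1+e]Q

  module _ (conditions : ∀ i → 1 ℕ.≤ i → 2 ℕ.* i ℕ.< n → CondI G η i × CondII G η i) where

    private
      2<n : 2 ℕ.< n
      2<n = ℕP.≤-trans (ℕP.m≤m*n 3 Q) (ℕP.≤-trans (ℕP.*-monoˡ-≤ Q (ℕP.≤ᵇ⇒≤ 3 16 _)) 16Q≤n)

      degreeConditions : ∀ i → 1 ℕ.≤ i → 2 ℕ.* i ℕ.< n → DegreeCondition G e i × DegreeCondition (transpose G) e i
      degreeConditions i 1≤i 2i<n =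
        degreeCondition G {η} {e} e≤ηn (2*m<n⇒m<n 2i<n) (proj₁ (conditions i 1≤i 2i<n)) ,
        degreeCondition (transpose G) {η} {e} e≤ηn (2*m<n⇒m<n 2i<n) (proj₂ (conditions i 1≤i 2i<n))

      ηn≤outdeg : ∀ (H : Digraph n) → CondI H η 1 → ∀ w → η * ⟦ n ⟧ ≤ ⟦ outdeg H w ⟧
      ηn≤outdeg H cond w = Fraction.r*⟦⟧≤⟦⟧ P d c (outdeg H w) n (ℕP.<⇒≤ (begin-strict
        P ℕ.* n          <⟨ Pn<[1+e]Q ⟩
        suc e ℕ.* Q      ≤⟨ ℕP.*-monoˡ-≤ Q (1+e≤outdeg H (ℕP.<⇒≤ 2<n) (degreeCondition H {η} {e} e≤ηn 1<n cond) w) ⟩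
        outdeg H w ℕ.* Q ∎))
        where
        open ℕP.≤-Reasoning
        1<n : 1 ℕ.< n
        1<n = ℕP.<-trans (s≤s (s≤s z≤n)) 2<n

    semidegree : MinSemidegreeAtLeast G (η * ⟦ n ⟧)
    semidegree w = ηn≤outdeg G (proj₁ conditions₁) w , ηn≤outdeg (transpose G) (proj₂ conditions₁) w
      where
      conditions₁ : CondI G η 1 × CondII G η 1
      conditions₁ = conditions 1 (s≤s z≤n) 2<n

    expansion : RobustOutexpander G ν τ
    expansion S τn<S S<[1-τ]n = begin
      ⟦ ∣ S ∣ ⟧ + ν * ⟦ n ⟧      ≤⟨ ℚP.+-monoʳ-≤ ⟦ ∣ S ∣ ⟧ νn≤1+b ⟩
      ⟦ ∣ S ∣ ⟧ + ⟦ suc b ⟧      ≡⟨ ⟦⟧-homo-+ ∣ S ∣ (suc b) ⟨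
      ⟦ ∣ S ∣ ℕ.+ suc b ⟧        ≤⟨ ⟦⟧-mono-≤ S+b<RN ⟩
      ⟦ ∣ RN⁺ ν G S ∣ ⟧          ∎
      where
      open ℚP.≤-Reasoning
      inS X : Fin n → Bool
      inS w = does (w ∈? S)
      X w = does (ν * ⟦ n ⟧ ℚP.≤? ⟦ inNbrsIn G S w ⟧)

      sparse : ∀ w → T (not (X w)) → count (λ u → inS u ∧ adj G u w) ℕ.≤ b
      sparse w w∉X = ℕ.s≤s⁻¹ (subst (ℕ._< suc b) (countV≡count (λ u → inS u ∧ adj G u w))
        (⟦⟧-cancel-< (ℚP.<-≤-trans inNbrs<νn νn≤1+b)))
        where
        inNbrs<νn : ⟦ inNbrsIn G S w ⟧ < ν * ⟦ n ⟧
        inNbrs<νn = ℚP.≰⇒> (does-false⇒¬ (ν * ⟦ n ⟧ ℚP.≤? ⟦ inNbrsIn G S w ⟧) w∉X)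

      ∣S∣≡ : ∣ S ∣ ≡ count inS
      ∣S∣≡ = ∣∣≡count S

      a<S : a ℕ.< count inS
      a<S = subst (a ℕ.<_) ∣S∣≡ (⟦⟧-cancel-< (ℚP.≤-<-trans a≤τn τn<S))

      S+a<n : count inS ℕ.+ a ℕ.< n
      S+a<n = subst (λ s → s ℕ.+ a ℕ.< n) ∣S∣≡ (⟦⟧-cancel-< (begin-strict
        ⟦ ∣ S ∣ ℕ.+ a ⟧            ≡⟨ ⟦⟧-homo-+ ∣ S ∣ a ⟩
        ⟦ ∣ S ∣ ⟧ + ⟦ a ⟧          ≤⟨ ℚP.+-monoʳ-≤ ⟦ ∣ S ∣ ⟧ a≤τn ⟩
        ⟦ ∣ S ∣ ⟧ + τ * ⟦ n ⟧      <⟨ <-⇒+< (subst (⟦ ∣ S ∣ ⟧ <_) (1-*-distrib τ ⟦ n ⟧) S<[1-τ]n) ⟩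
        ⟦ n ⟧                      ∎))

      S+b<RN : ∣ S ∣ ℕ.+ suc b ℕ.≤ ∣ RN⁺ ν G S ∣
      S+b<RN = subst₂ ℕ._≤_ (trans (sym (ℕP.+-suc (count inS) b)) (cong (ℕ._+ suc b) (sym ∣S∣≡)))
        (sym (∣tabulate∣≡count X))
        (Core.expands G inS X a≡b+1+h e≡a+b+g 1≤g nb<g[1+h] sparse a<S S+a<n degreeConditions)

HoldsFrom : ℚ → ℚ → ℕ → Set
HoldsFrom η τ n₀ = (n : ℕ) → n₀ ℕ.≤ n → (G : Digraph n) →
  ((i : ℕ) → 1 ℕ.≤ i → 2 ℕ.* i ℕ.< n → CondI G η i × CondII G η i) →
  MinSemidegreeAtLeast G (η * ⟦ n ⟧) × RobustOutexpander G (τ * τ) τ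

mainTheorem7 : (η : ℚ) → ℚ.0ℚ ℚ.< η → η ℚ.< ℚ.1ℚ →
    Σ ℚ λ τ₀ → ℚ.0ℚ ℚ.< τ₀ ×
      ((τ : ℚ) → ℚ.0ℚ ℚ.< τ → τ ℚ.≤ τ₀ →
        Σ ℕ λ n₀ → 0 ℕ.< n₀ ×
          ((n : ℕ) → n₀ ℕ.≤ n → (G : Digraph n) →
            ((i : ℕ) → 1 ℕ.≤ i → 2 ℕ.* i ℕ.< n → CondI G η i × CondII G η i) →
            MinSemidegreeAtLeast G (η ℚ.* ⟦ n ⟧) × RobustOutexpander G (τ ℚ.* τ) τ))
mainTheorem7 (mkℚ (ℤ.+ 0) _ _) (ℚ.*<* (ℤ.+<+ ())) _
mainTheorem7 (mkℚ ℤ.-[1+ _ ] _ _) (ℚ.*<* ()) _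
mainTheorem7 η@(mkℚ (ℤ.+ suc p) d c) _ _ = τ₀ , ℚ.*<* (ℤ.+<+ (s≤s z≤n)) , choose-n₀
  where
  -- τ₀ = 1 / (8 (d + 1)).
  τ₀ : ℚ
  τ₀ = mkℚ (ℤ.+ 1) (d ℕ.+ 7 ℕ.* suc d) (1-coprimeTo _)
  choose-n₀ : (τ : ℚ) → ℚ.0ℚ ℚ.< τ → τ ℚ.≤ τ₀ → Σ ℕ λ n₀ → 0 ℕ.< n₀ × HoldsFrom η τ n₀
  choose-n₀ (mkℚ (ℤ.+ 0) _ _) (ℚ.*<* (ℤ.+<+ ())) _
  choose-n₀ (mkℚ ℤ.-[1+ _ ] _ _) (ℚ.*<* ()) _
  choose-n₀ (mkℚ (ℤ.+ suc u) v c′) _ (ℚ.*≤* τ≤τ₀) = 2 ℕ.* suc v , s≤s z≤n ,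
    λ n 2V≤n G conditions → semidegree n 2V≤n G conditions , expansion n 2V≤n G conditions
    where
    8QU≤V : 8 ℕ.* suc d ℕ.* suc u ℕ.≤ suc v
    8QU≤V = subst₂ ℕ._≤_ (ℕP.*-comm (suc u) (8 ℕ.* suc d)) (ℕP.*-identityˡ (suc v))
      (ℤP.drop‿+≤+ (subst₂ ℤ._≤_ (sym (ℤP.pos-* (suc u) (8 ℕ.* suc d))) (sym (ℤP.pos-* 1 (suc v))) τ≤τ₀))
    open Robust (suc p) d c u v c′ (s≤s z≤n) 8QU≤V
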